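{- For every odd integer $n\ge 3$, $\chi'_L(K_n)=n$, where $K_n$ is the complete graph on $n$ vertices.
   Context: For a proper edge coloring $c:E(G)\to\{1,\dots,k\}$ of a connected graph $G$, let $\pi=(\mathcal{C}_1,\dots,\mathcal{C}_k)$ be the ordered partition of $E(G)$ into color classes. For a vertex $v$ and an edge $e=xy$, $d(v,e)=\min\{d(v,x),d(v,y)\}$, and $d(v,\mathcal{C}_i)=\min\{d(v,e): e\in\mathcal{C}_i\}$. The edge color code of $v$ is $c_\pi(v)=(d(v,\mathcal{C}_1),\dots,d(v,\mathcal{C}_k))$. The coloring $c$ is an edge-locating coloring if distinct vertices have distinct edge color codes; $\chi'_L(G)$ is the minimum $k$ for which $G$ has an edge-locating coloring with $k$ colors. -}

module Defs where

open import Level using (0ℓ)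
open import Data.Nat using (ℕ; zero; suc; _⊓_; _≤_; _<_)
open import Data.Fin using (Fin)
open import Data.Product using (Σ; ∃; ∃-syntax; _×_; _,_)
open import Relation.Nullary using (¬_)
open import Relation.Binary.PropositionalEquality using (_≡_; _≢_)

record Graph (n : ℕ) : Set₁ where
  field
    Adj     : Fin n → Fin n → Set
    adj-sym : ∀ {x y} → Adj x y → Adj y x
    irrefl  : ∀ {x} → ¬ Adj x x
open Graph public

K : (n : ℕ) → Graph n
K n = record { Adj = λ x y → x ≢ y ; adj-sym = λ p q → p (Relation.Binary.PropositionalEquality.sym q) ; irrefl = λ p → p Relation.Binary.PropositionalEquality.refl }

module _ {n : ℕ} (G : Graph n) where

  data Walk : Fin n → Fin n → ℕ → Set where
    nil  : ∀ {u} → Walk u u 0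
    cons : ∀ {u w v k} → Adj G u w → Walk w v k → Walk u v (suc k)

  Dist : Fin n → Fin n → ℕ → Set
  Dist u v k = Walk u v k × (∀ m → m < k → ¬ Walk u v m)

  Connected : Set
  Connected = ∀ u v → ∃[ k ] Dist u v k

  DistToEdge : Fin n → Fin n → Fin n → ℕ → Set
  DistToEdge v x y d = ∃[ a ] ∃[ b ] (Dist v x a × Dist v y b × d ≡ a ⊓ b)

  -- A proper edge coloring with colors Fin k, every color class nonempty
  -- (so that π = (C_1,…,C_k) is an ordered partition of E(G)).
  record EdgeColoring (k : ℕ) : Set where
    field
      col      : (x y : Fin n) → Adj G x y → Fin k
      col-sym  : ∀ x y (e : Adj G x y) → col x y e ≡ col y x (adj-sym G e)
      proper   : ∀ x y z (e₁ : Adj G x y) (e₂ : Adj G x z) → y ≢ z → col x y e₁ ≢ col x z e₂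
      surj     : ∀ i → ∃[ x ] ∃[ y ] Σ (Adj G x y) (λ e → col x y e ≡ i)
  open EdgeColoring public

  DistToClass : ∀ {k} → EdgeColoring k → Fin n → Fin k → ℕ → Set
  DistToClass c v i d =
    (∃[ x ] ∃[ y ] Σ (Adj G x y) (λ e → col c x y e ≡ i × DistToEdge v x y d))
    × (∀ x y (e : Adj G x y) → col c x y e ≡ i → ∀ d′ → DistToEdge v x y d′ → d ≤ d′)

  EdgeLocating : ∀ {k} → EdgeColoring k → Set
  EdgeLocating {k} c = ∀ u v → u ≢ v →
    ∃[ i ] ∃[ a ] ∃[ b ] (DistToClass c u i a × DistToClass c v i b × a ≢ b)

  HasEdgeLocatingColoring : ℕ → Set
  HasEdgeLocatingColoring k = Σ (EdgeColoring k) EdgeLocating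

  EdgeLocatingChromaticIndex : ℕ → Set
  EdgeLocatingChromaticIndex k =
    HasEdgeLocatingColoring k × (∀ m → HasEdgeLocatingColoring m → k ≤ m)

{-# OPTIONS --safe #-}
-- Lower bound: with m < n colours, each vertex of K n has n − 1 ≥ m incident
-- edges in distinct colours, so it meets every colour and all edge colour codes
-- are the zero vector.
-- Upper bound: colour the edge xy by x + y mod n. For odd n, doubling is
-- invertible mod n, so in the class of colour 2u the vertices are matched
-- perfectly except for u itself: every v ≠ u is at distance 0 from that class,
-- u at distance 1. Hence the colour 2u separates u from all other vertices.
module Submission where

open import Defs
open import Data.Nat using (ℕ; suc; _+_; _*_; _≤_)
open import Data.Product using (∃-syntax)
open import Relation.Binary.PropositionalEquality using (_≡_)

open import Data.Nat as ℕ using (zero; _<_; _∸_; _%_; _/_; z≤n; s≤s; _≤?_; NonZero)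
open import Data.Nat.Properties
  using (≤-antisym; ≤-<-trans; m∸n≤m; m∸n≡0⇒m≤n; [m+n]∸[m+o]≡n∸o; *-distribʳ-∸; *-distribˡ-∸;
         *-suc; +-comm; +-assoc; +-identityʳ; m+[n∸m]≡n; <⇒≤; ≰⇒>; <⇒≱; n≤0⇒n≡0)
open import Data.Nat.DivMod using (_mod_; m≡m%n+[m/n]*n; %-distribˡ-+; m%n%n≡m%n; [m+n]%n≡m%n; m<n⇒m%n≡m)
open import Data.Nat.Divisibility using (_∣_; divides; >⇒∤)
open import Data.Nat.Coprimality using (Coprime; coprime-divisor; coprime-+; 1-coprimeTo)
open import Data.Fin using (Fin; zero; suc; toℕ; punchIn; punchOut; _≟_)
open import Data.Fin.Properties
  using (toℕ-injective; toℕ-fromℕ<; toℕ<n; punchInᵢ≢i; punchIn-injective; punchOut-injective; injective⇒≤; any?)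
open import Data.Product using (Σ; _,_)
open import Data.Sum using (_⊎_; inj₁; inj₂)
open import Function.Definitions using (Injective)
open import Relation.Nullary using (yes; no; contradiction)
open import Relation.Binary.PropositionalEquality
  using (refl; sym; trans; cong; cong₂; subst; _≢_; ≢-sym; module ≡-Reasoning)
open ≡-Reasoning

%≡%⇒∣∸ : ∀ m o n .{{_ : NonZero n}} → m % n ≡ o % n → n ∣ m ∸ o
%≡%⇒∣∸ m o n eq = divides (m / n ∸ o / n) (begin
  m ∸ o
    ≡⟨ cong₂ _∸_ (m≡m%n+[m/n]*n m n) (m≡m%n+[m/n]*n o n) ⟩
  (m % n + m / n * n) ∸ (o % n + o / n * n)
    ≡⟨ cong (λ r → (m % n + m / n * n) ∸ (r + o / n * n)) (sym eq) ⟩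
  (m % n + m / n * n) ∸ (m % n + o / n * n)
    ≡⟨ [m+n]∸[m+o]≡n∸o (m % n) _ _ ⟩
  m / n * n ∸ o / n * n
    ≡⟨ sym (*-distribʳ-∸ n (m / n) (o / n)) ⟩
  (m / n ∸ o / n) * n ∎)

∣∧<⇒≡0 : ∀ {d m} → d ∣ m → m < d → m ≡ 0
∣∧<⇒≡0 {m = zero}  _   _   = refl
∣∧<⇒≡0 {m = suc _} d∣m m<d = contradiction d∣m (>⇒∤ m<d)

∣∸⇒≤ : ∀ {n m o} → m < n → n ∣ m ∸ o → m ≤ o
∣∸⇒≤ {m = m} {o} m<n n∣m∸o = m∸n≡0⇒m≤n (∣∧<⇒≡0 n∣m∸o (≤-<-trans (m∸n≤m m o) m<n))

+-cancelˡ-%-< : ∀ x {y z n} .{{_ : NonZero n}} →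
  y < n → z < n → (x + y) % n ≡ (x + z) % n → y ≡ z
+-cancelˡ-%-< x {n = n} y<n z<n eq = ≤-antisym (≤-from y<n eq) (≤-from z<n (sym eq))
  where
  ≤-from : ∀ {y z} → y < n → (x + y) % n ≡ (x + z) % n → y ≤ z
  ≤-from {y} {z} y<n eq =
    ∣∸⇒≤ y<n (subst (n ∣_) ([m+n]∸[m+o]≡n∸o x y z) (%≡%⇒∣∸ (x + y) (x + z) n eq))

*-cancelˡ-%-< : ∀ {c y z n} .{{_ : NonZero n}} → Coprime n c →
  y < n → z < n → (c * y) % n ≡ (c * z) % n → y ≡ z
*-cancelˡ-%-< {c} {n = n} n⊥c y<n z<n eq = ≤-antisym (≤-from y<n eq) (≤-from z<n (sym eq))
  where
  ≤-from : ∀ {y z} → y < n → (c * y) % n ≡ (c * z) % n → y ≤ z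
  ≤-from {y} {z} y<n eq = ∣∸⇒≤ y<n (coprime-divisor n⊥c
    (subst (n ∣_) (sym (*-distribˡ-∸ c y z)) (%≡%⇒∣∸ (c * y) (c * z) n eq)))

[m+n%d]%d≡[m+n]%d : ∀ m n d .{{_ : NonZero d}} → (m + n % d) % d ≡ (m + n) % d
[m+n%d]%d≡[m+n]%d m n d = begin
  (m + n % d) % d           ≡⟨ %-distribˡ-+ m (n % d) d ⟩
  (m % d + n % d % d) % d   ≡⟨ cong (λ r → (m % d + r) % d) (m%n%n≡m%n n d) ⟩
  (m % d + n % d) % d       ≡⟨ sym (%-distribˡ-+ m n d) ⟩
  (m + n) % d               ∎

odd⇒coprime-2 : ∀ t → Coprime (suc (2 * t)) 2
odd⇒coprime-2 zero    = 1-coprimeTo 2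
odd⇒coprime-2 (suc t) =
  subst (λ m → Coprime m 2) (cong suc (sym (*-suc 2 t))) (coprime-+ (odd⇒coprime-2 t))

module _ {n : ℕ} {G : Graph n} where

  walk₀⇒≡ : ∀ {u w} → Walk G u w 0 → u ≡ w
  walk₀⇒≡ nil = refl

  dist-refl : ∀ v → Dist G v v 0
  dist-refl v = nil , λ _ ()

  adjacent⇒dist1 : ∀ {u w} → Adj G u w → Dist G u w 1
  adjacent⇒dist1 uw = cons uw nil , λ
    { zero    _       walk → irrefl G (subst (Adj G _) (sym (walk₀⇒≡ walk)) uw)
    ; (suc _) (s≤s ()) _
    }

  incident⇒distToEdge0 : ∀ {v w} → Adj G v w → DistToEdge G v v w 0
  incident⇒distToEdge0 {v} e = 0 , 1 , dist-refl v , adjacent⇒dist1 e , refl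

  distToEdge0⇒incident : ∀ {v x y} → DistToEdge G v x y 0 → v ≡ x ⊎ v ≡ y
  distToEdge0⇒incident (zero  , _     , (walk , _) , _ , _) = inj₁ (walk₀⇒≡ walk)
  distToEdge0⇒incident (suc _ , zero  , _ , (walk , _) , _) = inj₂ (walk₀⇒≡ walk)
  distToEdge0⇒incident (suc _ , suc _ , _ , _ , ())

  module _ {k : ℕ} (c : EdgeColoring G k) where

    incident⇒DistToClass0 : ∀ {v w i} (e : Adj G v w) → col c v w e ≡ i → DistToClass G c v i 0
    incident⇒DistToClass0 e eq = (_ , _ , e , eq , incident⇒distToEdge0 e) , λ _ _ _ _ _ _ → z≤n

    incident⇒distToClass≡0 : ∀ {v w i a} (e : Adj G v w) → col c v w e ≡ i →
      DistToClass G c v i a → a ≡ 0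
    incident⇒distToClass≡0 {v} {w} e eq (_ , minimal) =
      n≤0⇒n≡0 (minimal v w e eq 0 (incident⇒distToEdge0 e))

    unmet⇒distToClass1 : ∀ {v x y i} → (∀ w (e : Adj G v w) → col c v w e ≢ i) →
      Adj G v x → Adj G v y → (e : Adj G x y) → col c x y e ≡ i → DistToClass G c v i 1
    unmet⇒distToClass1 {v} {i = i} unmet vx vy e eq =
      (_ , _ , e , eq , (1 , 1 , adjacent⇒dist1 vx , adjacent⇒dist1 vy , refl)) , away
      where
      away : ∀ x y (e : Adj G x y) → col c x y e ≡ i → ∀ d → DistToEdge G v x y d → 1 ≤ d
      away x y e eq (suc _) _ = s≤s z≤n
      away x y e eq zero  dist with distToEdge0⇒incident dist
      ... | inj₁ refl = contradiction eq (unmet y e)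
      ... | inj₂ refl = contradiction (trans (sym (col-sym c x v e)) eq) (unmet x (adj-sym G e))

punchIn≢ : ∀ {n} (v : Fin (suc n)) j → v ≢ punchIn v j
punchIn≢ v j = ≢-sym (punchInᵢ≢i v j)

-- A vertex missing colour i would inject its n − 1 neighbours into the m − 1
-- remaining colours.
meets-every-color : ∀ {n m} (c : EdgeColoring (K n) m) → m < n →
  ∀ v i → ∃[ w ] Σ (v ≢ w) (λ e → col c v w e ≡ i)
meets-every-color {suc n} {suc m} c m<n v i
  with any? (λ j → col c v (punchIn v j) (punchIn≢ v j) ≟ i)
... | yes (j , eq) = punchIn v j , punchIn≢ v j , eq
... | no missing   = contradiction (injective⇒≤ f-injective) (<⇒≱ (ℕ.s<s⁻¹ m<n))
  where
  avoids : ∀ j → i ≢ col c v (punchIn v j) (punchIn≢ v j)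
  avoids j eq = missing (j , sym eq)
  f : Fin n → Fin m
  f j = punchOut (avoids j)
  f-injective : Injective _≡_ _≡_ f
  f-injective {j} {j′} eq with punchIn v j ≟ punchIn v j′
  ... | yes same = punchIn-injective v j j′ same
  ... | no differ =
    contradiction (punchOut-injective (avoids j) (avoids j′) eq) (proper c v _ _ _ _ differ)

locating-K⇒n≤colors : ∀ {n m} → 2 ≤ n → HasEdgeLocatingColoring (K n) m → n ≤ m
locating-K⇒n≤colors {n} {m} (s≤s (s≤s _)) (c , locating) with n ≤? m
... | yes n≤m = n≤m
... | no n≰m with locating zero (suc zero) (λ ())
... | i , a , b , d[0] , d[1] , a≢b =
  contradiction (trans (code≡0 zero d[0]) (sym (code≡0 (suc zero) d[1]))) a≢b
  where
  code≡0 : ∀ v {d} → DistToClass (K n) c v i d → d ≡ 0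
  code≡0 v with w , e , eq ← meets-every-color c (≰⇒> n≰m) v i = incident⇒distToClass≡0 c e eq

module SumColoring (k : ℕ) (n-odd : Coprime (suc (suc k)) 2) where

  n : ℕ
  n = suc (suc k)

  _⊕_ : Fin n → Fin n → Fin n
  x ⊕ y = (toℕ x + toℕ y) mod n

  -- n ∸ toℕ x stands for −x mod n (no truncation, since toℕ x < n).
  _⊖_ : Fin n → Fin n → Fin n
  i ⊖ x = (toℕ i + (n ∸ toℕ x)) mod n

  toℕ-mod : ∀ m → toℕ (m mod n) ≡ m % n
  toℕ-mod m = toℕ-fromℕ< _

  mod≡⇒%≡ : ∀ m o → m mod n ≡ o mod n → m % n ≡ o % n
  mod≡⇒%≡ m o eq = trans (sym (toℕ-mod m)) (trans (cong toℕ eq) (toℕ-mod o))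

  ⊕-comm : ∀ x y → x ⊕ y ≡ y ⊕ x
  ⊕-comm x y = cong (_mod n) (+-comm (toℕ x) (toℕ y))

  ⊕-cancelˡ : ∀ x {y z} → x ⊕ y ≡ x ⊕ z → y ≡ z
  ⊕-cancelˡ x {y} {z} eq = toℕ-injective
    (+-cancelˡ-%-< (toℕ x) (toℕ<n y) (toℕ<n z) (mod≡⇒%≡ (toℕ x + toℕ y) (toℕ x + toℕ z) eq))

  ⊕-diagonal-injective : ∀ x y → x ⊕ x ≡ y ⊕ y → x ≡ y
  ⊕-diagonal-injective x y eq = toℕ-injective (*-cancelˡ-%-< n-odd (toℕ<n x) (toℕ<n y) (begin
    (2 * X) % n  ≡⟨ cong (λ r → (X + r) % n) (+-identityʳ X) ⟩
    (X + X) % n  ≡⟨ mod≡⇒%≡ (X + X) (Y + Y) eq ⟩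
    (Y + Y) % n  ≡⟨ cong (λ r → (Y + r) % n) (sym (+-identityʳ Y)) ⟩
    (2 * Y) % n  ∎))
    where
    X = toℕ x
    Y = toℕ y

  ⊕-⊖ : ∀ x i → x ⊕ (i ⊖ x) ≡ i
  ⊕-⊖ x i = toℕ-injective (begin
    toℕ (x ⊕ (i ⊖ x))          ≡⟨ toℕ-mod (X + toℕ (i ⊖ x)) ⟩
    (X + toℕ (i ⊖ x)) % n      ≡⟨ cong (λ r → (X + r) % n) (toℕ-mod (I + (n ∸ X))) ⟩
    (X + (I + (n ∸ X)) % n) % n ≡⟨ [m+n%d]%d≡[m+n]%d X _ n ⟩
    (X + (I + (n ∸ X))) % n    ≡⟨ cong (_% n) sum ⟩
    (I + n) % n                ≡⟨ [m+n]%n≡m%n I n ⟩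
    I % n                      ≡⟨ m<n⇒m%n≡m (toℕ<n i) ⟩
    I                          ∎)
    where
    X = toℕ x
    I = toℕ i
    sum : X + (I + (n ∸ X)) ≡ I + n
    sum = begin
      X + (I + (n ∸ X)) ≡⟨ sym (+-assoc X I _) ⟩
      X + I + (n ∸ X)   ≡⟨ cong (_+ (n ∸ X)) (+-comm X I) ⟩
      I + X + (n ∸ X)   ≡⟨ +-assoc I X _ ⟩
      I + (X + (n ∸ X)) ≡⟨ cong (I +_) (m+[n∸m]≡n (<⇒≤ (toℕ<n x))) ⟩
      I + n             ∎

  ⊖-fixed⇒diagonal : ∀ x i → i ⊖ x ≡ x → x ⊕ x ≡ i
  ⊖-fixed⇒diagonal x i fixed = trans (cong (x ⊕_) (sym fixed)) (⊕-⊖ x i)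

  sumColoring : EdgeColoring (K n) n
  sumColoring = record
    { col     = λ x y _ → x ⊕ y
    ; col-sym = λ x y _ → ⊕-comm x y
    ; proper  = λ x y z _ _ y≢z eq → y≢z (⊕-cancelˡ x eq)
    ; surj    = every-color-used
    }
    where
    every-color-used : ∀ i → ∃[ x ] ∃[ y ] Σ (x ≢ y) (λ _ → x ⊕ y ≡ i)
    every-color-used i with i ⊖ zero ≟ zero
    ... | no moved = zero , i ⊖ zero , ≢-sym moved , ⊕-⊖ zero i
    ... | yes fixed = suc zero , i ⊖ suc zero , moved , ⊕-⊖ (suc zero) i
      where
      moved : suc zero ≢ i ⊖ suc zero
      moved fixed′ = contradiction (⊕-diagonal-injective zero (suc zero) (trans
        (⊖-fixed⇒diagonal zero i fixed) (sym (⊖-fixed⇒diagonal (suc zero) i (sym fixed′))))) λ ()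

  sumColoring-locating : EdgeLocating (K n) sumColoring
  sumColoring-locating u v u≢v = u ⊕ u , 1 , 0 , d[u] , d[v] , λ ()
    where
    unmet : ∀ w → u ≢ w → u ⊕ w ≢ u ⊕ u
    unmet w u≢w eq = u≢w (sym (⊕-cancelˡ u eq))

    d[u] : DistToClass (K n) sumColoring u (u ⊕ u) 1
    d[u] with x , y , x≢y , eq ← surj sumColoring (u ⊕ u) =
      unmet⇒distToClass1 sumColoring unmet u≢x u≢y x≢y eq
      where
      u≢x : u ≢ x
      u≢x refl = unmet y x≢y eq
      u≢y : u ≢ y
      u≢y refl = unmet x (≢-sym x≢y) (trans (⊕-comm u x) eq)

    d[v] : DistToClass (K n) sumColoring v (u ⊕ u) 0
    d[v] = incident⇒DistToClass0 sumColoring v≢partner (⊕-⊖ v (u ⊕ u))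
      where
      v≢partner : v ≢ (u ⊕ u) ⊖ v
      v≢partner fixed = u≢v (sym (⊕-diagonal-injective v u (⊖-fixed⇒diagonal v (u ⊕ u) (sym fixed))))

theorem9 : ∀ (n : ℕ) → (∃[ t ] n ≡ suc (2 * t)) → 3 ≤ n →
    EdgeLocatingChromaticIndex (K n) n
theorem9 (suc (suc (suc k))) (t , n≡2t+1) (s≤s (s≤s (s≤s _))) =
  (sumColoring , sumColoring-locating) , λ m → locating-K⇒n≤colors (s≤s (s≤s z≤n))
  where
  open SumColoring (suc k) (subst (λ m → Coprime m 2) (sym n≡2t+1) (odd⇒coprime-2 t))
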